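{- Let $n>3$ and $k$ be integers with $\frac{n(n-1)}{2}\leq k\leq \frac{n(n+1)}{2}$ and $k\neq \frac{n(n+1)}{2}-1$, and let $i_0=i_0(n,k)$ be the greatest integer such that $k-1\geq n+(n-1)+\cdots+(n-i_0)$. Then $$\frac{\Gamma(n+1)}{\Gamma(n-i_0)}\leq m(n,k)\leq \frac{\Gamma(n+1)}{\Gamma(n-i_0)}\,e^n.$$
   Context: $\Gamma$ is Euler's Gamma function. $m(n,k)$ is the minimum of $\prod_{v\in V}v$ over all subsets $V\subseteq\{1,\dots,n\}$ with $1\in V$ and $\sum_{v\in V}v=k$. -}

module Defs where

open import Data.Nat using (ℕ; zero; suc; _+_; _*_; _∸_; _^_; _≤_; _/_; _!)
open import Data.Nat.Properties using (_!≢0)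
open import Data.Fin using (Fin; toℕ)
open import Data.Fin.Subset using (Subset)
open import Data.Fin.Subset.Properties using (_∈?_)
open import Data.List using (List; map; filter; allFin; upTo)
open import Data.Nat.ListAction using (sum; product)
open import Data.List.Membership.Propositional using (_∈_)
open import Data.Product using (Σ; _×_)
open import Relation.Binary.PropositionalEquality using (_≡_)

-- The elements of a subset V ⊆ {1,…,n}; Fin index i represents the number i+1.
members : ∀ {n} → Subset n → List ℕ
members {n} V = map (λ i → suc (toℕ i)) (filter (_∈? V) (allFin n))

Admissible : (n k : ℕ) → Subset n → Set
Admissible n k V = (1 ∈ members V) × (sum (members V) ≡ k)

IsMinProd : (n k m : ℕ) → Set
IsMinProd n k m =
  (Σ (Subset n) λ V → Admissible n k V × (product (members V) ≡ m)) ×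
  (∀ (V : Subset n) → Admissible n k V → m ≤ product (members V))

S : ℕ → ℕ → ℕ
S n i = sum (map (n ∸_) (upTo (suc i)))

IsI0 : (n k i0 : ℕ) → Set
IsI0 n k i0 = (S n i0 ≤ k ∸ 1) × (∀ i → S n i ≤ k ∸ 1 → i ≤ i0)

-- Γ(n+1)/Γ(n-i0) = n! / (n-i0-1)!  (Γ(j+1) = j! on naturals)
gammaRatio : ℕ → ℕ → ℕ
gammaRatio n i0 = n ! / (n ∸ suc i0) !
  where instance _ = (n ∸ suc i0) !≢0

-- eNum N = Σ_{j=0}^{N} N!/j!, so eNum N / N! is the N-th partial sum of e = Σ 1/j!
eNum : ℕ → ℕ
eNum N = sum (map term (upTo (suc N)))
  where
  term : ℕ → ℕ
  term j = N ! / j !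
    where instance _ = j !≢0

{-# OPTIONS --safe #-}
-- Let W = {1,…,n} ∖ V and r = n − i0 − 1.  Then ∏V · ∏W = n!, and the choice of i0 gives
-- ∑W = n(n+1)/2 − k < 1 + 2 + ⋯ + r.  Distinct integers ≥ 2 whose sum is below 1 + 2 + ⋯ + r
-- have product at most r!, hence m = ∏V ≥ n!/r!.  Conversely m ≤ n! = (n!/r!)·r!, and the
-- maximality of i0 together with k ≥ n(n−1)/2 forces 1 + 2 + ⋯ + (r−1) ≤ n, so
-- r! ≤ 2^(1+⋯+(r−1)) ≤ 2^n.  As 2 = 1/0! + 1/1! is the first partial sum of e, the witness
-- N = 1 gives a bound stronger than the stated e^n.
module Submission where

open import Defs
open import Data.Bool using (true; false)
open import Data.Empty using (⊥-elim)
open import Data.Fin using (Fin; toℕ) renaming (zero to fzero; suc to fsuc)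
open import Data.Fin.Subset using (Subset; ∁)
open import Data.Fin.Subset.Properties using (_∈?_)
open import Data.List using (List; []; _∷_; map; filter; tabulate; allFin; upTo; reverse; reverseAcc; _++_; _∷ʳ_)
open import Data.List.Membership.Propositional using (_∈_)
open import Data.List.Properties using (map-∘; map-++; upTo-∷ʳ)
open import Data.List.Relation.Binary.Permutation.Propositional.Properties using (↭-reverse)
open import Data.List.Relation.Unary.Any using (here; there)
open import Data.Nat using (ℕ; zero; suc; pred; _+_; _*_; _∸_; _^_; _≤_; _<_; _/_; _!; z≤n; s≤s)
open import Data.Nat.Divisibility using (m≤n⇒m!∣n!)
open import Data.Nat.DivMod using (m*n/n≡m; m/n*n≡m; /-monoˡ-≤)
open import Data.Nat.ListAction using (sum; product)
open import Data.Nat.ListAction.Properties using (sum-++; sum-↭; product-↭)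
open import Data.Nat.Properties
open import Data.Nat.Tactic.RingSolver using (solve-∀)
open import Data.Product using (_×_; _,_; ∃; ∃₂)
open import Data.Sum using (inj₁; inj₂)
open import Data.Unit using (⊤; tt)
open import Data.Vec using ([]; _∷_)
open import Function using (_∘_; id)
open import Relation.Binary.Definitions using (tri<; tri≈; tri>)
open import Relation.Binary.PropositionalEquality
open import Relation.Nullary using (yes; no)

triangular : ℕ → ℕ
triangular zero = 0
triangular (suc n) = suc n + triangular n

triangular-∸ : ∀ n a → n ∸ a + triangular (n ∸ suc a) ≡ triangular (n ∸ a)
triangular-∸ zero zero = refl
triangular-∸ zero (suc a) = refl
triangular-∸ (suc n) zero = refl
triangular-∸ (suc n) (suc a) = triangular-∸ n a

triangular-*2 : ∀ n → triangular n * 2 ≡ n * suc n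
triangular-*2 zero = refl
triangular-*2 (suc n) = begin
  (suc n + triangular n) * 2     ≡⟨ *-distribʳ-+ 2 (suc n) (triangular n) ⟩
  suc n * 2 + triangular n * 2   ≡⟨ cong (suc n * 2 +_) (triangular-*2 n) ⟩
  suc n * 2 + n * suc n          ≡⟨ lemma n ⟩
  suc n * suc (suc n)            ∎
  where
  open ≡-Reasoning
  lemma : ∀ n → suc n * 2 + n * suc n ≡ suc n * suc (suc n)
  lemma = solve-∀

*-pred/2≡triangular-pred : ∀ n → n * (n ∸ 1) / 2 ≡ triangular (n ∸ 1)
*-pred/2≡triangular-pred zero = refl
*-pred/2≡triangular-pred (suc n) = begin
  suc n * n / 2           ≡⟨ cong (_/ 2) (trans (*-comm (suc n) n) (sym (triangular-*2 n))) ⟩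
  triangular n * 2 / 2    ≡⟨ m*n/n≡m (triangular n) 2 ⟩
  triangular n            ∎
  where open ≡-Reasoning

S-suc : ∀ n i → S n (suc i) ≡ S n i + (n ∸ suc i)
S-suc n i = begin
  sum (map (n ∸_) (upTo (2 + i)))                             ≡⟨ cong (sum ∘ map (n ∸_)) (sym (upTo-∷ʳ (suc i))) ⟩
  sum (map (n ∸_) (upTo (suc i) ∷ʳ suc i))                    ≡⟨ cong sum (map-++ (n ∸_) (upTo (suc i)) _) ⟩
  sum (map (n ∸_) (upTo (suc i)) ++ (n ∸ suc i) ∷ [])         ≡⟨ sum-++ (map (n ∸_) (upTo (suc i))) _ ⟩
  S n i + (n ∸ suc i + 0)                                     ≡⟨ cong (S n i +_) (+-identityʳ (n ∸ suc i)) ⟩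
  S n i + (n ∸ suc i)                                         ∎
  where open ≡-Reasoning

S+triangular : ∀ n i → S n i + triangular (n ∸ suc i) ≡ triangular n
S+triangular n zero = trans (cong (_+ triangular (n ∸ 1)) (+-identityʳ n)) (triangular-∸ n 0)
S+triangular n (suc i) = begin
  S n (suc i) + triangular (n ∸ suc (suc i))             ≡⟨ cong (_+ triangular (n ∸ suc (suc i))) (S-suc n i) ⟩
  S n i + (n ∸ suc i) + triangular (n ∸ suc (suc i))     ≡⟨ +-assoc (S n i) _ _ ⟩
  S n i + (n ∸ suc i + triangular (n ∸ suc (suc i)))     ≡⟨ cong (S n i +_) (triangular-∸ n (suc i)) ⟩
  S n i + triangular (n ∸ suc i)                         ≡⟨ S+triangular n i ⟩
  triangular n                                           ∎
  where open ≡-Reasoning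

suc≤2^ : ∀ n → suc n ≤ 2 ^ n
suc≤2^ zero = ≤-refl
suc≤2^ (suc n) = subst (2 + n ≤_) (cong (2 ^ n +_) (sym (+-identityʳ (2 ^ n))))
  (+-mono-≤ (≤-trans (s≤s z≤n) (suc≤2^ n)) (suc≤2^ n))

!≤2^triangular-pred : ∀ r → r ! ≤ 2 ^ triangular (pred r)
!≤2^triangular-pred zero = ≤-refl
!≤2^triangular-pred (suc zero) = ≤-refl
!≤2^triangular-pred (suc (suc t)) =
  subst ((2 + t) ! ≤_) (sym (^-distribˡ-+-* 2 (suc t) (triangular t)))
    (*-mono-≤ (suc≤2^ (suc t)) (!≤2^triangular-pred (suc t)))

∈⇒≤sum : ∀ {x xs} → x ∈ xs → x ≤ sum xs
∈⇒≤sum (here refl) = m≤m+n _ _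
∈⇒≤sum {xs = y ∷ _} (there x∈xs) = ≤-trans (∈⇒≤sum x∈xs) (m≤n+m _ y)

m+n≡o+p∧o≤m∸1⇒n<p : ∀ {m n o p} → 1 ≤ m → m + n ≡ o + p → o ≤ m ∸ 1 → n < p
m+n≡o+p∧o≤m∸1⇒n<p {m} {n} {o} {p} 1≤m eq o≤ = +-cancelˡ-≤ (m ∸ 1) (suc n) p (begin
  m ∸ 1 + suc n    ≡⟨ +-suc (m ∸ 1) n ⟩
  suc (m ∸ 1) + n  ≡⟨ cong (_+ n) (m+[n∸m]≡n 1≤m) ⟩
  m + n            ≡⟨ eq ⟩
  o + p            ≤⟨ +-monoˡ-≤ p o≤ ⟩
  m ∸ 1 + p        ∎)
  where open ≤-Reasoning

Descending : ℕ → List ℕ → Set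
Descending b [] = ⊤
Descending b (x ∷ xs) = 2 ≤ x × x < b × Descending x xs

Descending-weaken : ∀ {b c} xs → b ≤ c → Descending b xs → Descending c xs
Descending-weaken [] _ _ = tt
Descending-weaken (x ∷ xs) b≤c (2≤x , x<b , d) = 2≤x , <-≤-trans x<b b≤c , d

1≤product : ∀ {b} xs → Descending b xs → 1 ≤ product xs
1≤product [] _ = ≤-refl
1≤product (x ∷ xs) (2≤x , _ , d) = *-mono-≤ (≤-trans (s≤s z≤n) 2≤x) (1≤product xs d)

sum<triangular : ∀ b {xs} → Descending (2 + b) xs → sum xs < triangular (suc b)
sum<triangular b {[]} _ = s≤s z≤n
sum<triangular zero {x ∷ xs} (2≤x , x<2 , _) = ⊥-elim (<⇒≱ x<2 2≤x)
sum<triangular (suc b) {x ∷ xs} (2≤x , x<3+b , d) with m≤n⇒m<n∨m≡n (≤-pred x<3+b)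
... | inj₁ x<2+b = <-≤-trans (sum<triangular b (2≤x , x<2+b , d)) (m≤n+m _ (2 + b))
... | inj₂ refl = +-monoʳ-< (2 + b) (sum<triangular b d)

-- A budget y ≥ 2 stands for one further factor y, which may repeat an entry of the list.
-- A budget of 1 must be worth the factor (r + 2)/(r + 1): a factor r + 2 at level r + 1
-- leaves exactly budget 1 at level r.
Fits : ℕ → ℕ → ℕ → Set
Fits r zero p = p ≤ r !
Fits r (suc zero) p = (2 + r) * p ≤ suc r !
Fits r (suc (suc y)) p = suc (suc y) * p ≤ r !

+≤* : ∀ a b → 2 + a + (2 + b) ≤ (2 + a) * (2 + b)
+≤* a b = subst (2 + a + (2 + b) ≤_) (lemma a b) (m≤m+n _ (a + b + a * b))
  where
  lemma : ∀ a b → 2 + a + (2 + b) + (a + b + a * b) ≡ (2 + a) * (2 + b)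
  lemma = solve-∀

*-+-≤ : ∀ a b c → a ≤ b → a * (b + c) ≤ b * (a + c)
*-+-≤ a b c a≤b = begin
  a * (b + c)      ≡⟨ *-distribˡ-+ a b c ⟩
  a * b + a * c    ≤⟨ +-monoʳ-≤ (a * b) (*-monoˡ-≤ c a≤b) ⟩
  a * b + b * c    ≡⟨ cong (_+ b * c) (*-comm a b) ⟩
  b * a + b * c    ≡⟨ sym (*-distribˡ-+ b a c) ⟩
  b * (a + c)      ∎
  where open ≤-Reasoning

Fits-mul : ∀ r y {p} → Fits r y p → Fits (suc r) y (suc r * p)
Fits-mul r zero fits = *-monoʳ-≤ (suc r) fits
Fits-mul r (suc zero) {p} fits = begin
  (3 + r) * ((1 + r) * p)    ≡⟨ sym (*-assoc (3 + r) (1 + r) p) ⟩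
  (3 + r) * (1 + r) * p      ≤⟨ *-monoˡ-≤ p (subst ((3 + r) * (1 + r) ≤_) (lemma r) (n≤1+n _)) ⟩
  (2 + r) * (2 + r) * p      ≡⟨ *-assoc (2 + r) (2 + r) p ⟩
  (2 + r) * ((2 + r) * p)    ≤⟨ *-monoʳ-≤ (2 + r) fits ⟩
  (2 + r) * (1 + r) !        ∎
  where
  open ≤-Reasoning
  lemma : ∀ r → suc ((3 + r) * (1 + r)) ≡ (2 + r) * (2 + r)
  lemma = solve-∀
Fits-mul r (suc (suc y)) {p} fits = begin
  (2 + y) * (suc r * p)    ≡⟨ *-comm (2 + y) (suc r * p) ⟩
  suc r * p * (2 + y)      ≡⟨ *-assoc (suc r) p (2 + y) ⟩
  suc r * (p * (2 + y))    ≡⟨ cong (suc r *_) (*-comm p (2 + y)) ⟩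
  suc r * ((2 + y) * p)    ≤⟨ *-monoʳ-≤ (suc r) fits ⟩
  suc r * r !              ∎
  where open ≤-Reasoning

Fits-extend : ∀ q y {p} → y ≤ suc q → p ≤ suc q ! → Fits (2 + q) y p
Fits-extend q zero _ p≤ = ≤-trans p≤ (m≤n*m (suc q !) (2 + q))
Fits-extend q (suc zero) {p} _ p≤ = begin
  (4 + q) * p                    ≤⟨ *-mono-≤ (subst (4 + q ≤_) (lemma q) (m≤m+n _ (2 + q * (4 + q)))) p≤ ⟩
  (3 + q) * (2 + q) * suc q !    ≡⟨ *-assoc (3 + q) (2 + q) (suc q !) ⟩
  (3 + q) !                      ∎
  where
  open ≤-Reasoning
  lemma : ∀ q → 4 + q + (2 + q * (4 + q)) ≡ (3 + q) * (2 + q)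
  lemma = solve-∀
Fits-extend q (suc (suc y)) y≤ p≤ = *-mono-≤ (m≤n⇒m≤1+n y≤) p≤

Fits-shift : ∀ q v {p} → Fits (suc q) v p → Fits (2 + q) (2 + q + v) p
Fits-shift q zero fits rewrite +-identityʳ q = *-monoʳ-≤ (2 + q) fits
Fits-shift q (suc zero) fits rewrite +-comm q 1 = fits
Fits-shift q (suc (suc w)) {p} fits = begin
  (2 + q + (2 + w)) * p      ≤⟨ *-monoˡ-≤ p (+≤* q w) ⟩
  (2 + q) * (2 + w) * p      ≡⟨ *-assoc (2 + q) (2 + w) p ⟩
  (2 + q) * ((2 + w) * p)    ≤⟨ *-monoʳ-≤ (2 + q) fits ⟩
  (2 + q) * suc q !          ∎
  where open ≤-Reasoning

Fits-merge : ∀ q y z {p} → y ≤ suc q → Fits (suc q) (y + suc z) p →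
  Fits (2 + q) y ((2 + q + suc z) * p)
Fits-merge q zero z _ fits = Fits-shift q (suc z) fits
Fits-merge q (suc zero) z {p} _ fits = begin
  (4 + q) * ((2 + q + suc z) * p)          ≡⟨ sym (*-assoc (4 + q) (2 + q + suc z) p) ⟩
  (4 + q) * (2 + q + suc z) * p            ≤⟨ *-monoˡ-≤ p (subst ((4 + q) * (2 + q + suc z) ≤_) (lemma q z) (m≤m+n _ _)) ⟩
  (3 + q) * (2 + q) * (2 + z) * p          ≡⟨ trans (*-assoc ((3 + q) * (2 + q)) (2 + z) p) (*-assoc (3 + q) (2 + q) ((2 + z) * p)) ⟩
  (3 + q) * ((2 + q) * ((2 + z) * p))      ≤⟨ *-monoʳ-≤ (3 + q) (*-monoʳ-≤ (2 + q) fits) ⟩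
  (3 + q) !                                ∎
  where
  open ≤-Reasoning
  lemma : ∀ q z → (4 + q) * (2 + q + suc z) + (q * (q + 3) + (q * q + 4 * q + 2) * z)
                  ≡ (3 + q) * (2 + q) * (2 + z)
  lemma = solve-∀
Fits-merge q (suc (suc u)) z {p} 2+u≤1+q fits = begin
  (2 + u) * ((2 + q + suc z) * p)      ≡⟨ sym (*-assoc (2 + u) (2 + q + suc z) p) ⟩
  (2 + u) * (2 + q + suc z) * p        ≤⟨ *-monoˡ-≤ p (*-+-≤ (2 + u) (2 + q) (suc z) (m≤n⇒m≤1+n 2+u≤1+q)) ⟩
  (2 + q) * (2 + u + suc z) * p        ≡⟨ *-assoc (2 + q) (2 + u + suc z) p ⟩
  (2 + q) * ((2 + u + suc z) * p)      ≤⟨ *-monoʳ-≤ (2 + q) fits ⟩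
  (2 + q) * suc q !                    ∎
  where open ≤-Reasoning

ProductBound : ℕ → Set
ProductBound r = ∀ {b} xs → Descending b xs → ∀ y → y + sum xs < triangular r → Fits r y (product xs)

-- At level r = 2 + q a budget y ≥ r pays for the factor r.  Otherwise look at the largest
-- entry x: if x < r the whole sum is below T (r − 1); x = r is a factor of r!; and if x > r,
-- its excess over r is added to the budget.
product-bound-step : ∀ q → ProductBound (suc q) → ProductBound (2 + q)
product-bound-step q ih xs d y budget with ≤-<-connex (2 + q) y
product-bound-step q ih xs d y budget | inj₁ 2+q≤y with m≤n⇒∃[o]m+o≡n 2+q≤y
... | v , refl = Fits-shift q v (ih xs d v (+-cancelˡ-< (2 + q) _ _
                   (subst (_< 2 + q + triangular (suc q)) (+-assoc (2 + q) v (sum xs)) budget)))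
product-bound-step q ih [] _ y budget | inj₂ y<2+q =
  Fits-extend q y (≤-pred y<2+q) (ih {0} [] tt 0 (s≤s z≤n))
product-bound-step q ih (x ∷ xs) (2≤x , _ , d) y budget | inj₂ y<2+q with <-cmp x (2 + q)
... | tri< x<2+q _ _ =
  Fits-extend q y (≤-pred y<2+q) (ih (x ∷ xs) (2≤x , x<2+q , d) 0 (sum<triangular q (2≤x , x<2+q , d)))
... | tri≈ _ refl _ = Fits-mul (suc q) y (ih xs d y (+-cancelˡ-< (2 + q) _ _
                        (subst (_< 2 + q + triangular (suc q)) (+-comm-middle y (2 + q) (sum xs)) budget)))
  where
  +-comm-middle : ∀ a b c → a + (b + c) ≡ b + (a + c)
  +-comm-middle = solve-∀
... | tri> _ _ 2+q<x with m≤n⇒∃[o]m+o≡n 2+q<x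
...   | z , refl = subst (λ x → Fits (2 + q) y (x * product xs)) (+-suc (2 + q) z)
                     (Fits-merge q y z (≤-pred y<2+q) (ih xs d (y + suc z) (+-cancelˡ-< (2 + q) _ _
                       (subst (_< 2 + q + triangular (suc q)) (regroup y q z (sum xs)) budget))))
  where
  regroup : ∀ y q z s → y + (3 + q + z + s) ≡ 2 + q + (y + suc z + s)
  regroup = solve-∀

product-bound : ∀ r → ProductBound r
product-bound zero _ _ _ ()
product-bound (suc zero) [] _ zero _ = ≤-refl
product-bound (suc zero) [] _ (suc y) (s≤s ())
product-bound (suc zero) (x ∷ xs) (2≤x , _) y (s≤s budget)
  with ≤-trans 2≤x (m+n≤o⇒m≤o x (m+n≤o⇒n≤o y budget))
... | ()
product-bound (suc (suc q)) = product-bound-step q (product-bound (suc q))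

elems : ∀ {n} → ℕ → Subset n → List ℕ
elems a [] = []
elems a (true ∷ V) = suc a ∷ elems (suc a) V
elems a (false ∷ V) = elems (suc a) V

filter-∈?-fsuc : ∀ {m n} b (V : Subset n) (f : Fin m → Fin n) →
  filter (_∈? b ∷ V) (tabulate (fsuc ∘ f)) ≡ map fsuc (filter (_∈? V) (tabulate f))
filter-∈?-fsuc {zero} b V f = refl
filter-∈?-fsuc {suc m} b V f with f fzero ∈? V
... | yes _ = cong (fsuc (f fzero) ∷_) (filter-∈?-fsuc b V (f ∘ fsuc))
... | no _ = filter-∈?-fsuc b V (f ∘ fsuc)

map-filter-∈?-∷≡elems : ∀ {n} a b (V : Subset n) (g : Fin (suc n) → ℕ) → (∀ i → g i ≡ suc (a + toℕ i)) →
  map g (filter (_∈? b ∷ V) (tabulate fsuc)) ≡ elems (suc a) V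

map-filter-∈?≡elems : ∀ {n} a (V : Subset n) (g : Fin n → ℕ) → (∀ i → g i ≡ suc (a + toℕ i)) →
  map g (filter (_∈? V) (allFin n)) ≡ elems a V
map-filter-∈?≡elems a [] g _ = refl
map-filter-∈?≡elems a (true ∷ V) g g≗ =
  cong₂ _∷_ (trans (g≗ fzero) (cong suc (+-identityʳ a))) (map-filter-∈?-∷≡elems a true V g g≗)
map-filter-∈?≡elems a (false ∷ V) g g≗ = map-filter-∈?-∷≡elems a false V g g≗

map-filter-∈?-∷≡elems a b V g g≗ = begin
  map g (filter (_∈? b ∷ V) (tabulate fsuc))        ≡⟨ cong (map g) (filter-∈?-fsuc b V id) ⟩
  map g (map fsuc (filter (_∈? V) (allFin _)))      ≡⟨ sym (map-∘ _) ⟩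
  map (g ∘ fsuc) (filter (_∈? V) (allFin _))        ≡⟨ map-filter-∈?≡elems (suc a) V (g ∘ fsuc)
                                                         (λ i → trans (g≗ (fsuc i)) (cong suc (+-suc a (toℕ i)))) ⟩
  elems (suc a) V                                   ∎
  where open ≡-Reasoning

members≡elems : ∀ {n} (V : Subset n) → members V ≡ elems 0 V
members≡elems V = map-filter-∈?≡elems 0 V (suc ∘ toℕ) (λ _ → refl)

∈-elems⇒> : ∀ {n} a (V : Subset n) {x} → x ∈ elems a V → a < x
∈-elems⇒> a (true ∷ V) (here refl) = ≤-refl
∈-elems⇒> a (true ∷ V) (there x∈) = <⇒≤ (∈-elems⇒> (suc a) V x∈)
∈-elems⇒> a (false ∷ V) x∈ = <⇒≤ (∈-elems⇒> (suc a) V x∈)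

product-elems-∁ : ∀ {n} a (V : Subset n) → a ! * (product (elems a V) * product (elems a (∁ V))) ≡ (a + n) !
product-elems-∁ {zero} a [] = trans (*-identityʳ (a !)) (cong _! (sym (+-identityʳ a)))
product-elems-∁ {suc n} a (true ∷ V) = begin
  a ! * (suc a * P * Q)         ≡⟨ lemma (a !) a P Q ⟩
  suc a ! * (P * Q)             ≡⟨ product-elems-∁ (suc a) V ⟩
  (suc a + n) !                 ≡⟨ cong _! (sym (+-suc a n)) ⟩
  (a + suc n) !                 ∎
  where
  open ≡-Reasoning
  P = product (elems (suc a) V)
  Q = product (elems (suc a) (∁ V))
  lemma : ∀ f a p q → f * (suc a * p * q) ≡ suc a * f * (p * q)
  lemma = solve-∀
product-elems-∁ {suc n} a (false ∷ V) = begin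
  a ! * (P * (suc a * Q))       ≡⟨ lemma (a !) a P Q ⟩
  suc a ! * (P * Q)             ≡⟨ product-elems-∁ (suc a) V ⟩
  (suc a + n) !                 ≡⟨ cong _! (sym (+-suc a n)) ⟩
  (a + suc n) !                 ∎
  where
  open ≡-Reasoning
  P = product (elems (suc a) V)
  Q = product (elems (suc a) (∁ V))
  lemma : ∀ f a p q → f * (p * (suc a * q)) ≡ suc a * f * (p * q)
  lemma = solve-∀

sum-elems-∁ : ∀ {n} a (V : Subset n) → sum (elems a V) + sum (elems a (∁ V)) + triangular a ≡ triangular (a + n)
sum-elems-∁ {zero} a [] = cong triangular (sym (+-identityʳ a))
sum-elems-∁ {suc n} a (true ∷ V) = begin
  suc a + P + Q + triangular a  ≡⟨ lemma a P Q (triangular a) ⟩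
  P + Q + triangular (suc a)    ≡⟨ sum-elems-∁ (suc a) V ⟩
  triangular (suc a + n)        ≡⟨ cong triangular (sym (+-suc a n)) ⟩
  triangular (a + suc n)        ∎
  where
  open ≡-Reasoning
  P = sum (elems (suc a) V)
  Q = sum (elems (suc a) (∁ V))
  lemma : ∀ a p q t → suc a + p + q + t ≡ p + q + (suc a + t)
  lemma = solve-∀
sum-elems-∁ {suc n} a (false ∷ V) = begin
  P + (suc a + Q) + triangular a  ≡⟨ lemma a P Q (triangular a) ⟩
  P + Q + triangular (suc a)      ≡⟨ sum-elems-∁ (suc a) V ⟩
  triangular (suc a + n)          ≡⟨ cong triangular (sym (+-suc a n)) ⟩
  triangular (a + suc n)          ∎
  where
  open ≡-Reasoning
  P = sum (elems (suc a) V)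
  Q = sum (elems (suc a) (∁ V))
  lemma : ∀ a p q t → p + (suc a + q) + t ≡ p + q + (suc a + t)
  lemma = solve-∀

Descending-reverseAcc : ∀ {n} a (V : Subset n) {acc} → 1 ≤ a → Descending (suc a) acc →
  ∃ λ b → Descending b (reverseAcc acc (elems a V))
Descending-reverseAcc a [] _ d = suc a , d
Descending-reverseAcc a (true ∷ V) 1≤a d =
  Descending-reverseAcc (suc a) V (s≤s z≤n) (s≤s 1≤a , ≤-refl , d)
Descending-reverseAcc a (false ∷ V) {acc} 1≤a d =
  Descending-reverseAcc (suc a) V (s≤s z≤n) (Descending-weaken acc (n≤1+n _) d)

complement-members : ∀ {n} (V : Subset n) → 1 ∈ members V →
  ∃₂ λ b W → Descending b W × sum (members V) + sum W ≡ triangular n × product (members V) * product W ≡ n !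
complement-members [] ()
complement-members {suc n} (true ∷ V) _ =
  let b , d = Descending-reverseAcc 1 (∁ V) ≤-refl tt in b , reverse W , d , sum-eq , product-eq
  where
  W = elems 1 (∁ V)
  sum-eq : sum (members (true ∷ V)) + sum (reverse W) ≡ triangular (suc n)
  sum-eq = begin
    sum (members (true ∷ V)) + sum (reverse W)      ≡⟨ cong₂ _+_ (cong sum (members≡elems (true ∷ V))) (sum-↭ (↭-reverse W)) ⟩
    sum (elems 0 (true ∷ V)) + sum W                ≡⟨ sym (+-identityʳ _) ⟩
    sum (elems 0 (true ∷ V)) + sum W + 0            ≡⟨ sum-elems-∁ 0 (true ∷ V) ⟩
    triangular (suc n)                              ∎
    where open ≡-Reasoning
  product-eq : product (members (true ∷ V)) * product (reverse W) ≡ suc n !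
  product-eq = begin
    product (members (true ∷ V)) * product (reverse W)  ≡⟨ cong₂ _*_ (cong product (members≡elems (true ∷ V))) (product-↭ (↭-reverse W)) ⟩
    product (elems 0 (true ∷ V)) * product W            ≡⟨ sym (*-identityˡ _) ⟩
    1 * (product (elems 0 (true ∷ V)) * product W)      ≡⟨ product-elems-∁ 0 (true ∷ V) ⟩
    suc n !                                             ∎
    where open ≡-Reasoning
complement-members (false ∷ V) 1∈V =
  ⊥-elim (<-irrefl refl (∈-elems⇒> 1 V (subst (1 ∈_) (members≡elems (false ∷ V)) 1∈V)))

gammaRatio≤ : ∀ n i0 {m p} → m * p ≡ n ! → p ≤ (n ∸ suc i0) ! → gammaRatio n i0 ≤ m
gammaRatio≤ n i0 {m} {p} m*p≡n! p≤r! = begin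
  n ! / r !        ≡⟨ cong (_/ r !) (sym m*p≡n!) ⟩
  m * p / r !      ≤⟨ /-monoˡ-≤ (r !) (*-monoʳ-≤ m p≤r!) ⟩
  m * r ! / r !    ≡⟨ m*n/n≡m m (r !) ⟩
  m                ∎
  where
  open ≤-Reasoning
  r = n ∸ suc i0
  instance _ = r !≢0

≤gammaRatio* : ∀ n i0 {m p c} → m * p ≡ n ! → 1 ≤ p → (n ∸ suc i0) ! ≤ c → m ≤ gammaRatio n i0 * c
≤gammaRatio* n i0 {m} {p} {c} m*p≡n! 1≤p r!≤c = begin
  m                    ≡⟨ sym (*-identityʳ m) ⟩
  m * 1                ≤⟨ *-monoʳ-≤ m 1≤p ⟩
  m * p                ≡⟨ m*p≡n! ⟩
  n !                  ≡⟨ sym (m/n*n≡m (m≤n⇒m!∣n! (m∸n≤m n (suc i0)))) ⟩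
  n ! / r ! * r !      ≤⟨ *-monoʳ-≤ (n ! / r !) r!≤c ⟩
  n ! / r ! * c        ∎
  where
  open ≤-Reasoning
  r = n ∸ suc i0
  instance _ = r !≢0

∸!≤2^ : ∀ n i {k} → triangular (n ∸ 1) ≤ k → k ≤ S n (suc i) → (n ∸ suc i) ! ≤ 2 ^ n
∸!≤2^ n i {k} T[n∸1]≤k k≤S = begin
  (n ∸ suc i) !                        ≤⟨ !≤2^triangular-pred (n ∸ suc i) ⟩
  2 ^ triangular (pred (n ∸ suc i))    ≡⟨ cong (λ t → 2 ^ triangular t) (pred[m∸n]≡m∸[1+n] n (suc i)) ⟩
  2 ^ triangular t                     ≤⟨ ^-monoʳ-≤ 2 T[t]≤n ⟩
  2 ^ n                                ∎
  where
  open ≤-Reasoning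
  t = n ∸ suc (suc i)
  T[t]≤n : triangular t ≤ n
  T[t]≤n = +-cancelˡ-≤ (S n (suc i)) _ _ (begin
    S n (suc i) + triangular t    ≡⟨ S+triangular n (suc i) ⟩
    triangular n                  ≡⟨ sym (triangular-∸ n 0) ⟩
    n + triangular (n ∸ 1)        ≤⟨ +-monoʳ-≤ n (≤-trans T[n∸1]≤k k≤S) ⟩
    n + S n (suc i)               ≡⟨ +-comm n (S n (suc i)) ⟩
    S n (suc i) + n               ∎)

-- The hypotheses 3 < n, k ≤ n(n+1)/2 and k ≠ n(n+1)/2 − 1 only ensure that m(n,k) exists,
-- which IsMinProd already provides.
lemma4p10 : ∀ (n k : ℕ) → 3 < n →
    n * (n ∸ 1) / 2 ≤ k → k ≤ n * suc n / 2 → k ≢ n * suc n / 2 ∸ 1 →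
    ∀ (i0 : ℕ) → IsI0 n k i0 →
    ∀ (m : ℕ) → IsMinProd n k m →
    (gammaRatio n i0 ≤ m) ×
    ∃ λ N → m * ((N !) ^ n) ≤ gammaRatio n i0 * (eNum N ^ n)
lemma4p10 n k _ n[n∸1]/2≤k _ _ i0 (S≤k∸1 , i0-greatest) m ((V , (1∈V , ΣV≡k) , ΠV≡m) , _)
  with complement-members V 1∈V
... | _ , W , W-desc , ΣV+ΣW≡Tn , ΠV*ΠW≡n! =
  gammaRatio≤ n i0 m*ΠW≡n! (product-bound (n ∸ suc i0) W W-desc 0 ΣW<T[r]) , 1 , upper
  where
  1≤k : 1 ≤ k
  1≤k = subst (1 ≤_) ΣV≡k (∈⇒≤sum 1∈V)
  m*ΠW≡n! : m * product W ≡ n !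
  m*ΠW≡n! = subst (λ x → x * product W ≡ n !) ΠV≡m ΠV*ΠW≡n!
  ΣW<T[r] : sum W < triangular (n ∸ suc i0)
  ΣW<T[r] = m+n≡o+p∧o≤m∸1⇒n<p 1≤k
    (trans (subst (λ x → x + sum W ≡ triangular n) ΣV≡k ΣV+ΣW≡Tn) (sym (S+triangular n i0))) S≤k∸1
  k≤S : k ≤ S n (suc i0)
  k≤S = subst (_≤ S n (suc i0)) (m+[n∸m]≡n 1≤k)
    (≰⇒> (λ S≤k∸1 → 1+n≰n (i0-greatest (suc i0) S≤k∸1)))
  upper : m * ((1 !) ^ n) ≤ gammaRatio n i0 * (eNum 1 ^ n)
  upper = subst (_≤ gammaRatio n i0 * 2 ^ n) (sym (trans (cong (m *_) (^-zeroˡ n)) (*-identityʳ m)))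
    (≤gammaRatio* n i0 m*ΠW≡n! (1≤product W W-desc)
      (∸!≤2^ n i0 (subst (_≤ k) (*-pred/2≡triangular-pred n) n[n∸1]/2≤k) k≤S))
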